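{- Let $A\subset\mathbb{R}$ be a convex set and let $\{a_1<b_1\leq a_2<b_2\leq\cdots\leq a_k<b_k\}\subseteq A$. If $b_{i+1}-a_{i+1}\leq b_i-a_i$ for all $1\leq i<k$, then $\left|A\cap\bigcup_{i=1}^k(a_i,b_i)\right|\geq \frac{k(k-1)}{2}$. In particular, $k\leq C|A|^{1/2}$ for an absolute constant $C$.
   Context: A convex set is a finite set $A=\{a_1<\cdots<a_n\}\subset\mathbb{R}$ whose consecutive differences $a_{i+1}-a_i$ form a strictly increasing sequence. -}

module Defs where

open import Level using (0ℓ)
open import Data.Nat as ℕ using (ℕ; suc)
open import Data.Nat.Properties as ℕP using ()
open import Data.Fin using (Fin; fromℕ<; toℕ)
open import Data.Product using (Σ; ∃; _×_; _,_)
open import Data.Sum using (_⊎_)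
open import Relation.Binary.PropositionalEquality using (_≡_; _≢_)
open import Relation.Binary.Structures using (IsStrictTotalOrder)
open import Relation.Unary using (Pred)
open import Algebra.Structures using (IsCommutativeRing)
open import Function.Definitions using (Injective)

-- An axiomatic model of the real numbers: a Dedekind-complete ordered field
-- (equality is propositional equality on the carrier).
record RealField : Set₁ where
  infixl 6 _+_ _-_
  infixl 7 _*_
  infix 4 _<_ _≤_
  field
    ℝ    : Set
    _+_  : ℝ → ℝ → ℝ
    _*_  : ℝ → ℝ → ℝ
    -_   : ℝ → ℝ
    0#   : ℝ
    1#   : ℝ
    _<_  : ℝ → ℝ → Set
    isCommutativeRing : IsCommutativeRing _≡_ _+_ _*_ -_ 0# 1#
    0≢1  : 0# ≢ 1#
    inverse : ∀ x → x ≢ 0# → ∃ λ y → x * y ≡ 1#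
    isStrictTotalOrder : IsStrictTotalOrder _≡_ _<_
    +-mono-< : ∀ {x y} z → x < y → x + z < y + z
    *-pos    : ∀ {x y} → 0# < x → 0# < y → 0# < x * y

  _-_ : ℝ → ℝ → ℝ
  x - y = x + (- y)

  _≤_ : ℝ → ℝ → Set
  x ≤ y = x < y ⊎ x ≡ y

  UpperBound : Pred ℝ 0ℓ → ℝ → Set
  UpperBound S u = ∀ s → S s → s ≤ u

  field
    complete : (S : Pred ℝ 0ℓ) → (∃ λ s → S s) → (∃ λ u → UpperBound S u) →
               ∃ λ u → UpperBound S u × (∀ v → UpperBound S v → u ≤ v)

module _ (R : RealField) where
  open RealField R

  -- A finite set A = {x_0 < x_1 < ... < x_{n-1}} ⊂ ℝ, given by its increasing
  -- enumeration x, is convex iff x is strictly increasing and its consecutive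
  -- differences are strictly increasing.
  IsConvexEnum : (n : ℕ) → (Fin n → ℝ) → Set
  IsConvexEnum n x =
    (∀ (i : ℕ) (p : suc i ℕ.< n) →
       x (fromℕ< (ℕP.<-trans (ℕP.n<1+n i) p)) < x (fromℕ< p))
    ×
    (∀ (i : ℕ) (p : suc (suc i) ℕ.< n) →
       let q = ℕP.<-trans (ℕP.n<1+n (suc i)) p
           r = ℕP.<-trans (ℕP.n<1+n i) q
       in x (fromℕ< q) - x (fromℕ< r) < x (fromℕ< p) - x (fromℕ< q))

  _∈Enum_ : ℝ → ∀ {n} → (Fin n → ℝ) → Set
  y ∈Enum x = ∃ λ j → x j ≡ y

  IsIntervalChain : (k : ℕ) → (Fin k → ℝ) → (Fin k → ℝ) → Set
  IsIntervalChain k a b =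
    (∀ i → a i < b i) ×
    (∀ (i : ℕ) (p : suc i ℕ.< k) →
       b (fromℕ< (ℕP.<-trans (ℕP.n<1+n i) p)) ≤ a (fromℕ< p))

  NonIncreasingLengths : (k : ℕ) → (Fin k → ℝ) → (Fin k → ℝ) → Set
  NonIncreasingLengths k a b =
    ∀ (i : ℕ) (p : suc i ℕ.< k) →
      let q = ℕP.<-trans (ℕP.n<1+n i) p
      in b (fromℕ< p) - a (fromℕ< p) ≤ b (fromℕ< q) - a (fromℕ< q)

  InUnion : (k : ℕ) → (Fin k → ℝ) → (Fin k → ℝ) → ℝ → Set
  InUnion k a b y = ∃ λ (i : Fin k) → a i < y × y < b i

  -- |A ∩ ⋃_i (a_i,b_i)| ≥ m, where A = {x_j}: there are m distinct indices j
  -- (equivalently, since x is injective, m distinct elements of A) lying in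
  -- the union.
  CardAtLeast : (m n : ℕ) → (Fin n → ℝ) → (ℝ → Set) → Set
  CardAtLeast m n x P =
    Σ (Fin m → Fin n) λ f → Injective _≡_ _≡_ f × (∀ t → P (x (f t)))

{-# OPTIONS --safe #-}
module Submission where

open import Defs
open import Data.Nat using (ℕ; _*_; _∸_; _/_; _≤_)
open import Data.Fin using (Fin)
open import Data.Product using (_×_; ∃)

open import Data.Nat using (zero; suc; _+_; _<_; _≤?_; _<?_; z≤n; s≤s; z<s; s<s; s≤s⁻¹)
open import Data.Nat.Properties
open import Data.Nat.DivMod using (m*n/n≡m)
open import Data.Fin using (toℕ; fromℕ<; splitAt; _↑ˡ_; _↑ʳ_)
open import Data.Fin.Properties
  using ( toℕ<n; fromℕ<-toℕ; fromℕ<-injective; toℕ-injective; injective⇒≤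
        ; splitAt⁻¹-↑ˡ; splitAt⁻¹-↑ʳ)
open import Data.Vec.Functional using (Vector; []; _++_)
open import Data.Vec.Functional.Relation.Unary.All using (All)
open import Data.Product using (_,_; proj₁; proj₂)
open import Data.Sum using (inj₁; inj₂)
open import Function using (_∘_)
open import Function.Definitions using (Injective)
open import Relation.Binary.Bundles using (StrictPartialOrder)
open import Relation.Binary.Structures using (IsStrictTotalOrder)
open import Relation.Binary.Definitions using (tri<; tri≈; tri>)
open import Relation.Binary.PropositionalEquality
  using (_≡_; _≢_; refl; sym; trans; cong; cong₂; subst; subst₂; module ≡-Reasoning)
open import Relation.Nullary using (¬_; yes; no; contradiction)
open import Algebra.Bundles using (Group)
open import Algebra.Structures using (IsCommutativeRing)

-- Let pᵢ < qᵢ be the positions of aᵢ and bᵢ in A (counting from 0, i < k). Since the gaps of A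
-- increase, a window of A spanning a fixed number of gaps gets strictly longer as it moves
-- right; so qᵢ - pᵢ ≤ qᵢ₊₁ - pᵢ₊₁ would force bᵢ - aᵢ < bᵢ₊₁ - aᵢ₊₁. Hence the widths qᵢ - pᵢ
-- strictly decrease and, the last one being positive, qᵢ - pᵢ ≥ k - i. The positions
-- pᵢ + 1, …, pᵢ + (k - 1 - i) therefore lie strictly inside (aᵢ, bᵢ); these intervals are
-- disjoint, giving (k - 1) + ⋯ + 1 + 0 = k(k - 1)/2 points of A in the union.
-- Finally k² ≤ 2k(k - 1) ≤ 4|A| once k ≥ 2.

triangle : ℕ → ℕ
triangle zero    = 0
triangle (suc r) = r + triangle r

triangle*2≡k*[k∸1] : ∀ k → triangle k * 2 ≡ k * (k ∸ 1)
triangle*2≡k*[k∸1] zero          = refl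
triangle*2≡k*[k∸1] (suc zero)    = refl
triangle*2≡k*[k∸1] (suc (suc s)) = begin
  (suc s + triangle (suc s)) * 2  ≡⟨ *-distribʳ-+ 2 (suc s) (triangle (suc s)) ⟩
  suc s * 2 + triangle (suc s) * 2 ≡⟨ cong (suc s * 2 +_) (triangle*2≡k*[k∸1] (suc s)) ⟩
  suc s * 2 + suc s * s           ≡⟨ *-distribˡ-+ (suc s) 2 s ⟨
  suc s * suc (suc s)             ≡⟨ *-comm (suc s) (suc (suc s)) ⟩
  suc (suc s) * suc s             ∎
  where open ≡-Reasoning

k*[k∸1]/2≡triangle : ∀ k → k * (k ∸ 1) / 2 ≡ triangle k
k*[k∸1]/2≡triangle k = trans (cong (_/ 2) (sym (triangle*2≡k*[k∸1] k))) (m*n/n≡m (triangle k) 2)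

k*k≤4*triangle : ∀ k → 2 ≤ k → k * k ≤ 4 * triangle k
k*k≤4*triangle (suc zero) (s≤s ())
k*k≤4*triangle k@(suc (suc s)) _ = begin
  k * k                   ≤⟨ *-monoʳ-≤ k (s≤s (s≤s (m≤m*n s 2))) ⟩
  k * ((k ∸ 1) * 2)       ≡⟨ *-assoc k (k ∸ 1) 2 ⟨
  k * (k ∸ 1) * 2         ≡⟨ cong (_* 2) (triangle*2≡k*[k∸1] k) ⟨
  triangle k * 2 * 2      ≡⟨ *-assoc (triangle k) 2 2 ⟩
  triangle k * 4          ≡⟨ *-comm (triangle k) 4 ⟩
  4 * triangle k          ∎
  where open ≤-Reasoning

triangle≤n⇒k*k≤4*n : ∀ {k n} → (0 < k → 0 < n) → triangle k ≤ n → k * k ≤ 4 * n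
triangle≤n⇒k*k≤4*n {zero}            _   _   = z≤n
triangle≤n⇒k*k≤4*n {suc zero}    {n} n>0 _   = ≤-trans (n>0 z<s) (m≤n*m n 4)
triangle≤n⇒k*k≤4*n {k@(suc (suc _))} _   t≤n =
  ≤-trans (k*k≤4*triangle k (s≤s (s≤s z≤n))) (*-monoʳ-≤ 4 t≤n)

m+1+n≡o⇒m<o : ∀ {m n o} → m + suc n ≡ o → m < o
m+1+n≡o⇒m<o {m} refl = m<m+n m z<s

m+1+n≡o⇒1+m+n≡o : ∀ {m n o} → m + suc n ≡ o → suc m + n ≡ o
m+1+n≡o⇒1+m+n≡o {m} {n} e = trans (sym (+-suc m n)) e

module _ {A : Set} {m n : ℕ} (xs : Vector A m) (ys : Vector A n) where

  ++-all : ∀ (P : A → Set) → All P xs → All P ys → All P (xs ++ ys)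
  ++-all _ pxs pys i with splitAt m i
  ... | inj₁ i′ = pxs i′
  ... | inj₂ i′ = pys i′

  ++-injective : Injective _≡_ _≡_ xs → Injective _≡_ _≡_ ys → (∀ i j → xs i ≢ ys j) →
                 Injective _≡_ _≡_ (xs ++ ys)
  ++-injective xs-inj ys-inj disjoint {i} {j} eq
    with splitAt m i in split-i | splitAt m j in split-j
  ... | inj₁ i′ | inj₁ j′ =
    trans (sym (splitAt⁻¹-↑ˡ split-i)) (trans (cong (_↑ˡ n) (xs-inj eq)) (splitAt⁻¹-↑ˡ split-j))
  ... | inj₁ i′ | inj₂ j′ = contradiction eq (disjoint i′ j′)
  ... | inj₂ i′ | inj₁ j′ = contradiction (sym eq) (disjoint j′ i′)
  ... | inj₂ i′ | inj₂ j′ =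
    trans (sym (splitAt⁻¹-↑ʳ split-i)) (trans (cong (m ↑ʳ_) (ys-inj eq)) (splitAt⁻¹-↑ʳ split-j))

module IntervalPoints (k : ℕ) (P Q : ℕ → ℕ)
  (chained : ∀ i → suc i < k → Q i ≤ P (suc i))
  -- d = k - 1 - i, written without truncated subtraction
  (wide : ∀ i d → i + suc d ≡ k → suc d + P i ≤ Q i) where

  InSomeInterval : ℕ → Set
  InSomeInterval v = ∃ λ i → i < k × P i < v × v < Q i

  block : ℕ → (r : ℕ) → Vector ℕ r
  block i r s = suc (toℕ s) + P i

  block-injective : ∀ i r → Injective _≡_ _≡_ (block i r)
  block-injective i r = toℕ-injective ∘ suc-injective ∘ +-cancelʳ-≡ (P i) _ _

  points : (r i : ℕ) → Vector ℕ (triangle r)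
  points zero    i = []
  points (suc r) i = block i r ++ points r (suc i)

  module _ {i r : ℕ} (e : i + suc r ≡ k) where

    P<Q : P i < Q i
    P<Q = <-≤-trans (m<n+m (P i) z<s) (wide i r e)

    block-above : All (P i <_) (block i r)
    block-above s = m<n+m (P i) z<s

    block-below : All (_< Q i) (block i r)
    block-below s = <-≤-trans (+-monoˡ-< (P i) (s<s (toℕ<n s))) (wide i r e)

    block-inside : All InSomeInterval (block i r)
    block-inside s = i , m+1+n≡o⇒m<o e , block-above s , block-below s

  points-inside : ∀ r i → i + r ≡ k → All InSomeInterval (points r i)
  points-inside zero    i e ()
  points-inside (suc r) i e = ++-all (block i r) (points r (suc i)) InSomeInterval
    (block-inside e) (points-inside r (suc i) (m+1+n≡o⇒1+m+n≡o e))

  points-beyond : ∀ r i → suc i + r ≡ k → All (Q i <_) (points r (suc i))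
  points-beyond zero    i e ()
  points-beyond (suc r) i e = ++-all (block (suc i) r) (points r (suc (suc i))) (Q i <_)
    (λ s → ≤-<-trans Qᵢ≤Pᵢ₊₁ (block-above e s))
    (λ t → <-trans (≤-<-trans Qᵢ≤Pᵢ₊₁ (P<Q {suc i} e)) (points-beyond r (suc i) e′ t))
    where
    Qᵢ≤Pᵢ₊₁ = chained i (m+1+n≡o⇒m<o e)
    e′ = m+1+n≡o⇒1+m+n≡o {suc i} e

  points-injective : ∀ r i → i + r ≡ k → Injective _≡_ _≡_ (points r i)
  points-injective zero    i e {()}
  points-injective (suc r) i e = ++-injective (block i r) (points r (suc i))
    (block-injective i r) (points-injective r (suc i) e′)
    (λ s t → <⇒≢ (<-trans (block-below e s) (points-beyond r i e′ t)))
    where e′ = m+1+n≡o⇒1+m+n≡o e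

extend : ∀ {A : Set} → A → ∀ {n} → Vector A n → ℕ → A
extend d {n} f j with j <? n
... | yes j<n = f (fromℕ< j<n)
... | no  _   = d

extend-fromℕ< : ∀ {A : Set} (d : A) {n} (f : Vector A n) {j} (j<n : j < n) →
                extend d f j ≡ f (fromℕ< j<n)
extend-fromℕ< d {n} f {j} j<n with j <? n
... | yes _   = refl
... | no  j≮n = contradiction j<n j≮n

extend-toℕ : ∀ {A : Set} (d : A) {n} (f : Vector A n) (i : Fin n) → extend d f (toℕ i) ≡ f i
extend-toℕ d f i = trans (extend-fromℕ< d f (toℕ<n i)) (cong f (fromℕ<-toℕ i (toℕ<n i)))

module _ (R : RealField) where

  open RealField R using (ℝ; 0#; isCommutativeRing; isStrictTotalOrder)
    renaming (_+_ to _⊕_; _-_ to _⊖_; -_ to ⊝_; _<_ to _≺_; _≤_ to _≼_; +-mono-< to ⊕-monoˡ-≺)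
  open IsCommutativeRing isCommutativeRing using (+-isGroup)
    renaming (+-assoc to ⊕-assoc; +-comm to ⊕-comm)

  +-group : Group _ _
  +-group = record { isGroup = +-isGroup }

  open import Algebra.Properties.Group +-group using (//-rightDividesˡ)

  strictPartialOrder : StrictPartialOrder _ _ _
  strictPartialOrder = record
    { isStrictPartialOrder = IsStrictTotalOrder.isStrictPartialOrder isStrictTotalOrder }

  open StrictPartialOrder strictPartialOrder using (irrefl; asym) renaming (trans to ≺-trans)
  open import Relation.Binary.Reasoning.StrictPartialOrder strictPartialOrder

  ≺⇒⋡ : ∀ {x y} → x ≺ y → ¬ (y ≼ x)
  ≺⇒⋡ x≺y (inj₁ y≺x) = asym x≺y y≺x
  ≺⇒⋡ x≺y (inj₂ refl) = irrefl refl x≺y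

  ⊕-mono-≺ : ∀ {x y u v} → x ≺ y → u ≺ v → x ⊕ u ≺ y ⊕ v
  ⊕-mono-≺ {x} {y} {u} {v} x≺y u≺v = begin-strict
    x ⊕ u  <⟨ ⊕-monoˡ-≺ u x≺y ⟩
    y ⊕ u  ≡⟨ ⊕-comm y u ⟩
    u ⊕ y  <⟨ ⊕-monoˡ-≺ y u≺v ⟩
    v ⊕ y  ≡⟨ ⊕-comm v y ⟩
    y ⊕ v  ∎

  ⊖-monoˡ-≼ : ∀ z {x y} → x ≼ y → x ⊖ z ≼ y ⊖ z
  ⊖-monoˡ-≼ z (inj₁ x≺y) = inj₁ (⊕-monoˡ-≺ (⊝ z) x≺y)
  ⊖-monoˡ-≼ z (inj₂ refl) = inj₂ refl

  [x⊖y]⊕[y⊖z]≡x⊖z : ∀ x y z → (x ⊖ y) ⊕ (y ⊖ z) ≡ x ⊖ z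
  [x⊖y]⊕[y⊖z]≡x⊖z x y z =
    trans (sym (⊕-assoc (x ⊖ y) y (⊝ z))) (cong (_⊖ z) (//-rightDividesˡ y x))

  steps⇒≺ : ∀ (f : ℕ → ℝ) {j j′} → (∀ t → t < j′ → f t ≺ f (suc t)) → j < j′ → f j ≺ f j′
  steps⇒≺ f {j′ = suc j′} step j<j′ with m<1+n⇒m<n∨m≡n j<j′
  ... | inj₂ refl = step j′ (n<1+n j′)
  ... | inj₁ j<j″ =
    ≺-trans (steps⇒≺ f (λ t t<j′ → step t (m<n⇒m<1+n t<j′)) j<j″) (step j′ (n<1+n j′))

  module ConvexSequence (n : ℕ) (X : ℕ → ℝ)
    (increasing : ∀ j → suc j < n → X j ≺ X (suc j))
    (convex : ∀ j → suc (suc j) < n → X (suc j) ⊖ X j ≺ X (suc (suc j)) ⊖ X (suc j)) where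

    X-strictMono : ∀ {j j′} → j < j′ → j′ < n → X j ≺ X j′
    X-strictMono j<j′ j′<n = steps⇒≺ X (λ t t<j′ → increasing t (≤-<-trans t<j′ j′<n)) j<j′

    X-mono : ∀ {j j′} → j ≤ j′ → j′ < n → X j ≼ X j′
    X-mono j≤j′ j′<n with m≤n⇒m<n∨m≡n j≤j′
    ... | inj₁ j<j′ = inj₁ (X-strictMono j<j′ j′<n)
    ... | inj₂ refl = inj₂ refl

    X-cancel-≼ : ∀ {j j′} → j < n → X j ≼ X j′ → j ≤ j′
    X-cancel-≼ j<n Xj≼Xj′ = ≮⇒≥ (λ j′<j → ≺⇒⋡ (X-strictMono j′<j j<n) Xj≼Xj′)

    X-cancel-≺ : ∀ {j j′} → j < n → X j ≺ X j′ → j < j′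
    X-cancel-≺ {j} {j′} j<n Xj≺Xj′ with <-cmp j j′
    ... | tri< j<j′ _ _ = j<j′
    ... | tri≈ _ refl _ = contradiction Xj≺Xj′ (irrefl refl)
    ... | tri> _ _ j′<j = contradiction (X-strictMono j′<j j<n) (asym Xj≺Xj′)

    Δ : ℕ → ℝ
    Δ j = X (suc j) ⊖ X j

    Δ-strictMono : ∀ {j j′} → j < j′ → suc j′ < n → Δ j ≺ Δ j′
    Δ-strictMono j<j′ j′<n = steps⇒≺ Δ (λ t t<j′ → convex t (≤-<-trans (s≤s t<j′) j′<n)) j<j′

    increment : ℕ → ℕ → ℝ
    increment w j = X (w + j) ⊖ X j

    increment-suc : ∀ w j → increment (suc w) j ≡ Δ (w + j) ⊕ increment w j
    increment-suc w j = sym ([x⊖y]⊕[y⊖z]≡x⊖z (X (suc w + j)) (X (w + j)) (X j))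

    increment-strictMono : ∀ w {j j′} → j < j′ → suc w + j′ < n →
                           increment (suc w) j ≺ increment (suc w) j′
    increment-strictMono zero    j<j′ bound = Δ-strictMono j<j′ bound
    increment-strictMono (suc w) {j} {j′} j<j′ bound = begin-strict
      increment (2 + w) j             ≡⟨ increment-suc (suc w) j ⟩
      Δ (suc w + j) ⊕ increment (suc w) j
        <⟨ ⊕-mono-≺ (Δ-strictMono (+-monoʳ-< (suc w) j<j′) bound)
                    (increment-strictMono w j<j′ (<-trans (n<1+n _) bound)) ⟩
      Δ (suc w + j′) ⊕ increment (suc w) j′ ≡⟨ increment-suc (suc w) j′ ⟨
      increment (2 + w) j′            ∎

    later-wider⇒longer : ∀ w {p q p′ q′} → p < q → q ≤ w + p → p < p′ → w + p′ ≤ q′ → q′ < n →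
                         X q ⊖ X p ≺ X q′ ⊖ X p′
    later-wider⇒longer zero    p<q q≤p _ _ _ = contradiction q≤p (<⇒≱ p<q)
    later-wider⇒longer (suc w) {p} {q} {p′} {q′} p<q q≤w+p p<p′ w+p′≤q′ q′<n = begin-strict
      X q ⊖ X p             ≤⟨ ⊖-monoˡ-≼ (X p) (X-mono q≤w+p w+p<n) ⟩
      increment (suc w) p   <⟨ increment-strictMono w p<p′ w+p′<n ⟩
      increment (suc w) p′  ≤⟨ ⊖-monoˡ-≼ (X p′) (X-mono w+p′≤q′ q′<n) ⟩
      X q′ ⊖ X p′           ∎
      where
      w+p′<n = ≤-<-trans w+p′≤q′ q′<n
      w+p<n  = <-trans (+-monoʳ-< (suc w) p<p′) w+p′<n

  module Chain (n : ℕ) (x : Fin n → ℝ) (cv : IsConvexEnum R n x)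
    (k : ℕ) (a b : Fin k → ℝ) (ch : IsIntervalChain R k a b)
    (ha : ∀ i → _∈Enum_ R (a i) x) (hb : ∀ i → _∈Enum_ R (b i) x)
    (nl : NonIncreasingLengths R k a b) where

    X : ℕ → ℝ
    X = extend 0# x

    X-increasing : ∀ j → suc j < n → X j ≺ X (suc j)
    X-increasing j j+1<n = subst₂ _≺_
      (sym (extend-fromℕ< 0# x (<⇒≤ j+1<n))) (sym (extend-fromℕ< 0# x j+1<n)) (proj₁ cv j j+1<n)

    X-convex : ∀ j → suc (suc j) < n → X (suc j) ⊖ X j ≺ X (suc (suc j)) ⊖ X (suc j)
    X-convex j j+2<n = subst₂ _≺_
      (sym (cong₂ _⊖_ (extend-fromℕ< 0# x j+1<n) (extend-fromℕ< 0# x (<⇒≤ j+1<n))))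
      (sym (cong₂ _⊖_ (extend-fromℕ< 0# x j+2<n) (extend-fromℕ< 0# x j+1<n)))
      (proj₂ cv j j+2<n)
      where j+1<n = <⇒≤ j+2<n

    open ConvexSequence n X X-increasing X-convex

    position : (f : Fin k → ℝ) → (∀ i → _∈Enum_ R (f i) x) → ℕ → ℕ
    position f f∈x = extend 0 (toℕ ∘ proj₁ ∘ f∈x)

    position<n : ∀ f f∈x {i} → i < k → position f f∈x i < n
    position<n f f∈x i<k = subst (_< n) (sym (extend-fromℕ< 0 _ i<k)) (toℕ<n _)

    X∘position : ∀ f f∈x {i} (i<k : i < k) → X (position f f∈x i) ≡ f (fromℕ< i<k)
    X∘position f f∈x i<k = begin-equality
      X (position f f∈x _)              ≡⟨ cong X (extend-fromℕ< 0 _ i<k) ⟩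
      X (toℕ (proj₁ (f∈x (fromℕ< i<k)))) ≡⟨ extend-toℕ 0# x _ ⟩
      x (proj₁ (f∈x (fromℕ< i<k)))       ≡⟨ proj₂ (f∈x _) ⟩
      f (fromℕ< i<k)                     ∎

    P Q : ℕ → ℕ
    P = position a ha
    Q = position b hb

    L : ℕ → ℝ
    L i = X (Q i) ⊖ X (P i)

    P<Q : ∀ {i} → i < k → P i < Q i
    P<Q i<k = X-cancel-≺ (position<n a ha i<k)
      (subst₂ _≺_ (sym (X∘position a ha i<k)) (sym (X∘position b hb i<k)) (proj₁ ch _))

    Q≤P : ∀ i → suc i < k → Q i ≤ P (suc i)
    Q≤P i i+1<k = X-cancel-≼ (position<n b hb i<k)
      (subst₂ _≼_ (sym (X∘position b hb i<k)) (sym (X∘position a ha i+1<k)) (proj₂ ch i i+1<k))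
      where i<k = <⇒≤ i+1<k

    length-nonincreasing : ∀ i → suc i < k → L (suc i) ≼ L i
    length-nonincreasing i i+1<k = subst₂ _≼_
      (sym (cong₂ _⊖_ (X∘position b hb i+1<k) (X∘position a ha i+1<k)))
      (sym (cong₂ _⊖_ (X∘position b hb (<⇒≤ i+1<k)) (X∘position a ha (<⇒≤ i+1<k))))
      (nl i i+1<k)

    widens-leftward : ∀ i w → suc i < k → w + P (suc i) ≤ Q (suc i) → suc w + P i ≤ Q i
    widens-leftward i w i+1<k w+Pᵢ₊₁≤Qᵢ₊₁ with suc w + P i ≤? Q i
    ... | yes w+1+Pᵢ≤Qᵢ = w+1+Pᵢ≤Qᵢ
    ... | no  w+1+Pᵢ≰Qᵢ = contradiction (length-nonincreasing i i+1<k) (≺⇒⋡ longer)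
      where
      i<k = <⇒≤ i+1<k
      longer : L i ≺ L (suc i)
      longer = later-wider⇒longer w (P<Q i<k) (s≤s⁻¹ (≰⇒> w+1+Pᵢ≰Qᵢ))
        (<-≤-trans (P<Q i<k) (Q≤P i i+1<k)) w+Pᵢ₊₁≤Qᵢ₊₁ (position<n b hb i+1<k)

    wide : ∀ i d → i + suc d ≡ k → suc d + P i ≤ Q i
    wide i zero    e = P<Q (m+1+n≡o⇒m<o e)
    wide i (suc d) e = widens-leftward i (suc d) (m+1+n≡o⇒m<o e′) (wide (suc i) d e′)
      where e′ = m+1+n≡o⇒1+m+n≡o e

    open IntervalPoints k P Q Q≤P wide using (points; points-inside; points-injective)

    interior : Vector ℕ (triangle k)
    interior = points k 0

    interior<n : ∀ t → interior t < n
    interior<n t with points-inside k 0 refl t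
    ... | i , i<k , _ , v<Qᵢ = <-trans v<Qᵢ (position<n b hb i<k)

    card : CardAtLeast R (triangle k) n x (InUnion R k a b)
    card = chosen , injective , inUnion
      where
      chosen : Fin (triangle k) → Fin n
      chosen t = fromℕ< (interior<n t)

      injective : Injective _≡_ _≡_ chosen
      injective eq =
        points-injective k 0 refl (fromℕ<-injective _ _ (interior<n _) (interior<n _) eq)

      inUnion : ∀ t → InUnion R k a b (x (chosen t))
      inUnion t with points-inside k 0 refl t
      ... | i , i<k , Pᵢ<v , v<Qᵢ = fromℕ< i<k
        , subst₂ _≺_ (X∘position a ha i<k) (extend-fromℕ< 0# x (interior<n t))
            (X-strictMono Pᵢ<v (interior<n t))
        , subst₂ _≺_ (extend-fromℕ< 0# x (interior<n t)) (X∘position b hb i<k)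
            (X-strictMono v<Qᵢ (position<n b hb i<k))

    k*k≤4*n : k * k ≤ 4 * n
    k*k≤4*n = triangle≤n⇒k*k≤4*n (λ k>0 → ≤-<-trans z≤n (position<n a ha k>0))
      (injective⇒≤ (proj₁ (proj₂ card)))

lemma3p4 :
    ((R : RealField) → let open RealField R using (ℝ) in
      (n : ℕ) (x : Fin n → ℝ) → IsConvexEnum R n x →
      (k : ℕ) (a b : Fin k → ℝ) → IsIntervalChain R k a b →
      (∀ i → _∈Enum_ R (a i) x) → (∀ i → _∈Enum_ R (b i) x) →
      NonIncreasingLengths R k a b →
      CardAtLeast R (k * (k ∸ 1) / 2) n x (InUnion R k a b))
    ×
    (∃ λ (C : ℕ) → (R : RealField) → let open RealField R using (ℝ) in
      (n : ℕ) (x : Fin n → ℝ) → IsConvexEnum R n x →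
      (k : ℕ) (a b : Fin k → ℝ) → IsIntervalChain R k a b →
      (∀ i → _∈Enum_ R (a i) x) → (∀ i → _∈Enum_ R (b i) x) →
      NonIncreasingLengths R k a b →
      k * k ≤ C * n)
lemma3p4 =
  (λ R n x cv k a b ch ha hb nl →
    subst (λ m → CardAtLeast R m n x (InUnion R k a b)) (sym (k*[k∸1]/2≡triangle k))
      (Chain.card R n x cv k a b ch ha hb nl))
  , 4 , Chain.k*k≤4*n
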